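{- The formula $\forall g\,\forall x\,\forall y\,((\mathrm{Reif}(g,x)\land\mathrm{Reif}(g,y))\Rightarrow x=y)$ is derivable in $\mathrm{Z}_{st}$.
   Context: $\mathrm{Z}_{st}$ is intuitionistic Zermelo set theory with Strong Extensionality and Transitive Closure: equality axioms ($=$ reflexive, $x=x'\land x=y\Rightarrow x'=y$, $=$ compatible with $\in$ on both sides), the Strong Extensionality scheme $\forall a\forall b(R(a,b)\land\forall x\forall x'\forall y(x'\in x\land R(x,y)\Rightarrow\exists y'(y'\in y\land R(x',y')))\land\forall y\forall y'\forall x(y'\in y\land R(x,y)\Rightarrow\exists x'(x'\in x\land R(x',y')))\Rightarrow a=b)$ for every formula $R$ with parameters, Pairing, Union, Powerset, Restricted Comprehension (for every formula with parameters), Infinity, and Transitive Closure $\forall a\exists e(a\subseteq e\land\forall x\forall y(x\in y\land y\in e\Rightarrow x\in e))$. Set-theoretic notations below are used as definitional abbreviations. Notation: $\langle a,b\rangle=\{\{a\},\{a,b\}\}$. A graph is a set all of whose elements are ordered pairs; $\mathrm{Car}(A)=\{x\in\bigcup\bigcup A\mid\exists y\,(\langle x,y\rangle\in A\lor\langle y,x\rangle\in A)\}$. A function $\phi$ is a set of ordered pairs with $\langle x,y\rangle,\langle x,y'\rangle\in\phi\Rightarrow y=y'$; $\mathrm{Dom}(\phi)$ and $\mathrm{Cod}(\phi)$ are its sets of first and second components; $\phi(i)$ is the $y$ with $\langle i,y\rangle\in\phi$. $\mathrm{Collapse}(A,\phi)$ means: $A$ is a graph, $\phi$ is a function, $\mathrm{Dom}(\phi)=\mathrm{Car}(A)$,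 and for every $i\in\mathrm{Dom}(\phi)$ and every $x$: $x\in\phi(i)$ iff there exists $j\in\mathrm{Dom}(\phi)$ with $\langle j,i\rangle\in A$ and $x=\phi(j)$. $\hat\phi_A(i)=\{y\in\mathrm{Cod}(\phi)\mid\exists j\,(\langle j,i\rangle\in A\land\langle j,y\rangle\in\phi)\}$. $\mathrm{Reif}(g,x)$ (``$x$ is a reification of $g$'') is $\exists A\,\exists a\,\exists\phi\,(g=\langle A,a\rangle\land\mathrm{Collapse}(A,\phi)\land x=\hat\phi_A(a))$. -}

module Defs where

open import Data.Nat using (ℕ; zero; suc; _+_; _∸_)
open import Data.List using (List; []; _∷_; map)
open import Data.List.Membership.Propositional using (_∈_)

-- Syntax (variables are de Bruijn indices; the only terms are variables)

infixr 4 _⇒ᶠ_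
infixr 5 _∨ᶠ_
infixr 6 _∧ᶠ_
infix 7 _∈ᶠ_ _≐ᶠ_

data Fm : Set where
  _∈ᶠ_ : ℕ → ℕ → Fm
  _≐ᶠ_ : ℕ → ℕ → Fm
  ⊥ᶠ   : Fm
  _∧ᶠ_ : Fm → Fm → Fm
  _∨ᶠ_ : Fm → Fm → Fm
  _⇒ᶠ_ : Fm → Fm → Fm
  allᶠ : Fm → Fm
  exᶠ  : Fm → Fm

lift : (ℕ → ℕ) → ℕ → ℕ
lift ρ zero    = zero
lift ρ (suc k) = suc (ρ k)

ren : (ℕ → ℕ) → Fm → Fm
ren ρ (x ∈ᶠ y) = ρ x ∈ᶠ ρ y
ren ρ (x ≐ᶠ y) = ρ x ≐ᶠ ρ y
ren ρ ⊥ᶠ       = ⊥ᶠ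
ren ρ (φ ∧ᶠ ψ) = ren ρ φ ∧ᶠ ren ρ ψ
ren ρ (φ ∨ᶠ ψ) = ren ρ φ ∨ᶠ ren ρ ψ
ren ρ (φ ⇒ᶠ ψ) = ren ρ φ ⇒ᶠ ren ρ ψ
ren ρ (allᶠ φ) = allᶠ (ren (lift ρ) φ)
ren ρ (exᶠ φ)  = exᶠ (ren (lift ρ) φ)

-- substitution of the variable x for the variable 0 (the bound one)
inst : ℕ → ℕ → ℕ
inst x zero    = x
inst x (suc k) = k

-- Builder notation with named (level-based) variables, to write formulas
-- readably.  A builder is evaluated at the current binder depth.

Tm : Set
Tm = ℕ → ℕ

F : Set
F = ℕ → Fm

-- the variable bound by the binder introduced at depth l
var : ℕ → Tm
var l d = d ∸ suc l

infixr 4 _⇒_ _⇔_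
infixr 5 _∨_
infixr 6 _∧_
infix 7 _∈'_ _≐_

_∈'_ : Tm → Tm → F
(s ∈' t) d = s d ∈ᶠ t d

_≐_ : Tm → Tm → F
(s ≐ t) d = s d ≐ᶠ t d

⊥' : F
⊥' d = ⊥ᶠ

_∧_ _∨_ _⇒_ _⇔_ : F → F → F
(φ ∧ ψ) d = φ d ∧ᶠ ψ d
(φ ∨ ψ) d = φ d ∨ᶠ ψ d
(φ ⇒ ψ) d = φ d ⇒ᶠ ψ d
φ ⇔ ψ = (φ ⇒ ψ) ∧ (ψ ⇒ φ)

¬' : F → F
¬' φ = φ ⇒ ⊥'

All Ex : (Tm → F) → F
All f d = allᶠ (f (var d) (suc d))
Ex  f d = exᶠ  (f (var d) (suc d))

-- A scheme formula φ : Fm with k distinguished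
-- variables uses indices 0..k-1 for them and indices k+n for its
-- parameters (free variables) n.  Schemes are built at outermost depth 0,
-- so at depth d parameter n is the index n + d.
app1 : Fm → Tm → F
app1 φ s d = ren σ φ
  where
  σ : ℕ → ℕ
  σ zero    = s d
  σ (suc n) = n + d

app2 : Fm → Tm → Tm → F
app2 R s t d = ren σ R
  where
  σ : ℕ → ℕ
  σ zero          = s d
  σ (suc zero)    = t d
  σ (suc (suc n)) = n + d

-- R(a,b) with a = variable 0 and b = variable 1 of R
strongExt : Fm → F
strongExt R =
  All λ a → All λ b →
    (app2 R a b
     ∧ (All λ x → All λ x' → All λ y →
          (x' ∈' x ∧ app2 R x y) ⇒ Ex λ y' → y' ∈' y ∧ app2 R x' y')
     ∧ (All λ y → All λ y' → All λ x →
          (y' ∈' y ∧ app2 R x y) ⇒ Ex λ x' → x' ∈' x ∧ app2 R x' y'))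
    ⇒ a ≐ b

_⊆'_ : Tm → Tm → F
a ⊆' b = All λ z → z ∈' a ⇒ z ∈' b

-- φ(x) with x = variable 0 of φ
comprehension : Fm → F
comprehension φ =
  All λ a → Ex λ b → All λ x → x ∈' b ⇔ (x ∈' a ∧ app1 φ x)

data Axiom : Fm → Set where
  eq-refl   : Axiom ((All λ x → x ≐ x) 0)
  eq-euclid : Axiom ((All λ x → All λ x' → All λ y →
                       (x ≐ x' ∧ x ≐ y) ⇒ x' ≐ y) 0)
  eq-∈ˡ     : Axiom ((All λ x → All λ x' → All λ y →
                       (x ≐ x' ∧ x ∈' y) ⇒ x' ∈' y) 0)
  eq-∈ʳ     : Axiom ((All λ x → All λ y → All λ y' →
                       (y ≐ y' ∧ x ∈' y) ⇒ x ∈' y') 0)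
  strong-ext : (R : Fm) → Axiom (strongExt R 0)
  pairing   : Axiom ((All λ a → All λ b → Ex λ c → All λ x →
                       x ∈' c ⇔ (x ≐ a ∨ x ≐ b)) 0)
  union     : Axiom ((All λ a → Ex λ u → All λ x →
                       x ∈' u ⇔ (Ex λ y → y ∈' a ∧ x ∈' y)) 0)
  powerset  : Axiom ((All λ a → Ex λ p → All λ x →
                       x ∈' p ⇔ x ⊆' a) 0)
  separation : (φ : Fm) → Axiom (comprehension φ 0)
  infinity  : Axiom ((Ex λ w →
                       (Ex λ e → e ∈' w ∧ (All λ z → ¬' (z ∈' e)))
                       ∧ (All λ x → x ∈' w ⇒
                            Ex λ s → s ∈' w ∧ (All λ z →
                              z ∈' s ⇔ (z ∈' x ∨ z ≐ x)))) 0)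
  trans-closure : Axiom ((All λ a → Ex λ e →
                       a ⊆' e ∧ (All λ x → All λ y →
                         (x ∈' y ∧ y ∈' e) ⇒ x ∈' e)) 0)

infix 2 _⊢_

shiftCtx : List Fm → List Fm
shiftCtx Γ = map (ren suc) Γ

data _⊢_ (Γ : List Fm) : Fm → Set where
  hyp  : ∀ {φ} → φ ∈ Γ → Γ ⊢ φ
  ax   : ∀ {φ} → Axiom φ → Γ ⊢ φ
  ⊥E   : ∀ {φ} → Γ ⊢ ⊥ᶠ → Γ ⊢ φ
  ∧I   : ∀ {φ ψ} → Γ ⊢ φ → Γ ⊢ ψ → Γ ⊢ φ ∧ᶠ ψ
  ∧E₁  : ∀ {φ ψ} → Γ ⊢ φ ∧ᶠ ψ → Γ ⊢ φ
  ∧E₂  : ∀ {φ ψ} → Γ ⊢ φ ∧ᶠ ψ → Γ ⊢ ψ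
  ∨I₁  : ∀ {φ ψ} → Γ ⊢ φ → Γ ⊢ φ ∨ᶠ ψ
  ∨I₂  : ∀ {φ ψ} → Γ ⊢ ψ → Γ ⊢ φ ∨ᶠ ψ
  ∨E   : ∀ {φ ψ χ} → Γ ⊢ φ ∨ᶠ ψ → φ ∷ Γ ⊢ χ → ψ ∷ Γ ⊢ χ → Γ ⊢ χ
  ⇒I   : ∀ {φ ψ} → φ ∷ Γ ⊢ ψ → Γ ⊢ φ ⇒ᶠ ψ
  ⇒E   : ∀ {φ ψ} → Γ ⊢ φ ⇒ᶠ ψ → Γ ⊢ φ → Γ ⊢ ψ
  ∀I   : ∀ {φ} → shiftCtx Γ ⊢ φ → Γ ⊢ allᶠ φ
  ∀E   : ∀ {φ} → Γ ⊢ allᶠ φ → (x : ℕ) → Γ ⊢ ren (inst x) φ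
  ∃I   : ∀ {φ} (x : ℕ) → Γ ⊢ ren (inst x) φ → Γ ⊢ exᶠ φ
  ∃E   : ∀ {φ ψ} → Γ ⊢ exᶠ φ → φ ∷ shiftCtx Γ ⊢ ren suc ψ → Γ ⊢ ψ

IsSing : Tm → Tm → F
IsSing z a = All λ w → w ∈' z ⇔ w ≐ a

IsDbl : Tm → Tm → Tm → F
IsDbl z a b = All λ w → w ∈' z ⇔ (w ≐ a ∨ w ≐ b)

IsPair : Tm → Tm → Tm → F
IsPair p a b = All λ z → z ∈' p ⇔ (IsSing z a ∨ IsDbl z a b)

PairIn : Tm → Tm → Tm → F
PairIn a b A = Ex λ p → p ∈' A ∧ IsPair p a b

InUU : Tm → Tm → F
InUU x A = Ex λ u → Ex λ v → u ∈' A ∧ v ∈' u ∧ x ∈' v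

Graph : Tm → F
Graph A = All λ p → p ∈' A ⇒ Ex λ u → Ex λ v → IsPair p u v

InCar : Tm → Tm → F
InCar x A = InUU x A ∧ (Ex λ y → PairIn x y A ∨ PairIn y x A)

Function : Tm → F
Function φ = Graph φ ∧ (All λ x → All λ y → All λ y' →
                (PairIn x y φ ∧ PairIn x y' φ) ⇒ y ≐ y')

InDom : Tm → Tm → F
InDom x φ = Ex λ y → PairIn x y φ

InCod : Tm → Tm → F
InCod y φ = Ex λ x → PairIn x y φ

InApp : Tm → Tm → Tm → F
InApp x φ i = Ex λ y → PairIn i y φ ∧ x ∈' y

EqApp : Tm → Tm → Tm → F
EqApp x φ j = Ex λ y → PairIn j y φ ∧ x ≐ y

Collapse : Tm → Tm → F
Collapse A φ =
  Graph A ∧ Function φ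
  ∧ (All λ x → InDom x φ ⇔ InCar x A)
  ∧ (All λ i → InDom i φ ⇒ All λ x →
       InApp x φ i ⇔ (Ex λ j → InDom j φ ∧ PairIn j i A ∧ EqApp x φ j))

IsHat : Tm → Tm → Tm → Tm → F
IsHat x φ A i = All λ y → y ∈' x ⇔
  (InCod y φ ∧ (Ex λ j → PairIn j i A ∧ PairIn j y φ))

Reif : Tm → Tm → F
Reif g x = Ex λ A → Ex λ a → Ex λ φ →
  IsPair g A a ∧ Collapse A φ ∧ IsHat x φ A a

reifUnique : Fm
reifUnique = (All λ g → All λ x → All λ y →
               (Reif g x ∧ Reif g y) ⇒ x ≐ y) 0

Z-st⊢ : Fm → Set
Z-st⊢ φ = [] ⊢ φ

{-# OPTIONS --safe #-}
module Submission where

-- Let g = ⟨A, a⟩ = ⟨A', a'⟩ have reifications x = φ̂_A(a) and y = ψ̂_A'(a').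
-- Kuratowski pairs are injective, so A = A' and a = a'.  The relation
--   R(u, w) :≡ (∃ i. u = φ(i) ∧ w = ψ(i)) ∨ (u = x ∧ w = y)
-- is then a bisimulation: the elements of φ(i) are the φ(j) with ⟨j, i⟩ ∈ A,
-- the elements of x are the φ(j) with ⟨j, a⟩ ∈ A, and likewise for ψ and y,
-- while Dom φ = Car A = Dom ψ.  Strong Extensionality applied to R gives x = y.
--
-- Derived rules are proved as closed implications whose free variables are
-- the natural-number parameters (via V), and are used in other contexts by
-- weakening with wk.

open import Defs
open import Data.Nat using (ℕ; suc; _+_)
open import Data.List using ([]; _∷_)
open import Data.List.Relation.Unary.Any using (here; there)
open import Data.List.Relation.Binary.Subset.Propositional using (_⊆_)
open import Data.List.Relation.Binary.Subset.Propositional.Properties using (map⁺; ∷⁺ʳ)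
open import Relation.Binary.PropositionalEquality using (refl)

weaken : ∀ {Γ Δ φ} → Γ ⊆ Δ → Γ ⊢ φ → Δ ⊢ φ
weaken s (hyp p)    = hyp (s p)
weaken s (ax a)     = ax a
weaken s (⊥E d)     = ⊥E (weaken s d)
weaken s (∧I d e)   = ∧I (weaken s d) (weaken s e)
weaken s (∧E₁ d)    = ∧E₁ (weaken s d)
weaken s (∧E₂ d)    = ∧E₂ (weaken s d)
weaken s (∨I₁ d)    = ∨I₁ (weaken s d)
weaken s (∨I₂ d)    = ∨I₂ (weaken s d)
weaken s (∨E d e f) = ∨E (weaken s d) (weaken (∷⁺ʳ _ s) e) (weaken (∷⁺ʳ _ s) f)
weaken s (⇒I d)     = ⇒I (weaken (∷⁺ʳ _ s) d)
weaken s (⇒E d e)   = ⇒E (weaken s d) (weaken s e)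
weaken s (∀I d)     = ∀I (weaken (map⁺ (ren suc) s) d)
weaken s (∀E d x)   = ∀E (weaken s d) x
weaken s (∃I x d)   = ∃I x (weaken s d)
weaken s (∃E d e)   = ∃E (weaken s d) (weaken (∷⁺ʳ _ (map⁺ (ren suc) s)) e)

wk : ∀ {Γ φ} → [] ⊢ φ → Γ ⊢ φ
wk = weaken (λ ())

infixl 5 _∙_
_∙_ : ∀ {Γ φ ψ} → Γ ⊢ φ ⇒ᶠ ψ → Γ ⊢ φ → Γ ⊢ ψ
_∙_ = ⇒E

h0 : ∀ {a Γ} → a ∷ Γ ⊢ a
h0 = hyp (here refl)
h1 : ∀ {a b Γ} → b ∷ a ∷ Γ ⊢ a
h1 = hyp (there (here refl))
h2 : ∀ {a b c Γ} → c ∷ b ∷ a ∷ Γ ⊢ a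
h2 = hyp (there (there (here refl)))
h3 : ∀ {a b c d Γ} → d ∷ c ∷ b ∷ a ∷ Γ ⊢ a
h3 = hyp (there (there (there (here refl))))
h4 : ∀ {a b c d e Γ} → e ∷ d ∷ c ∷ b ∷ a ∷ Γ ⊢ a
h4 = hyp (there (there (there (there (here refl)))))
h5 : ∀ {a b c d e f Γ} → f ∷ e ∷ d ∷ c ∷ b ∷ a ∷ Γ ⊢ a
h5 = hyp (there (there (there (there (there (here refl))))))
h6 : ∀ {a b c d e f g Γ} → g ∷ f ∷ e ∷ d ∷ c ∷ b ∷ a ∷ Γ ⊢ a
h6 = hyp (there (there (there (there (there (there (here refl)))))))
h7 : ∀ {a b c d e f g h Γ} → h ∷ g ∷ f ∷ e ∷ d ∷ c ∷ b ∷ a ∷ Γ ⊢ a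
h7 = hyp (there (there (there (there (there (there (there (here refl))))))))
h8 : ∀ {a b c d e f g h i Γ} → i ∷ h ∷ g ∷ f ∷ e ∷ d ∷ c ∷ b ∷ a ∷ Γ ⊢ a
h8 = hyp (there (there (there (there (there (there (there (there (here refl)))))))))

≐-refl : ∀ {Γ} x → Γ ⊢ x ≐ᶠ x
≐-refl x = ∀E (ax eq-refl) x

≐-sym : ∀ {Γ x y} → Γ ⊢ x ≐ᶠ y → Γ ⊢ y ≐ᶠ x
≐-sym {x = x} {y} p = ∀E (∀E (∀E (ax eq-euclid) x) y) x ∙ ∧I p (≐-refl x)

≐-trans : ∀ {Γ x y z} → Γ ⊢ x ≐ᶠ y → Γ ⊢ y ≐ᶠ z → Γ ⊢ x ≐ᶠ z
≐-trans {x = x} {y} {z} p q = ∀E (∀E (∀E (ax eq-euclid) y) x) z ∙ ∧I (≐-sym p) q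

∈-respʳ-≐ : ∀ {Γ x y y'} → Γ ⊢ y ≐ᶠ y' → Γ ⊢ x ∈ᶠ y → Γ ⊢ x ∈ᶠ y'
∈-respʳ-≐ {x = x} {y} {y'} p q = ∀E (∀E (∀E (ax eq-∈ʳ) x) y) y' ∙ ∧I p q

-- The free variable with index k at depth 0, seen from binder depth d.
V : ℕ → Tm
V k d = d + k

IsDbl-resp-snd : ∀ z j a a' →
  [] ⊢ (V a ≐ V a' ⇒ IsDbl (V z) (V j) (V a) ⇒ IsDbl (V z) (V j) (V a')) 0
IsDbl-resp-snd z j a a' = ⇒I (⇒I (∀I (∧I
  (⇒I (∨E (∧E₁ (∀E h1 0) ∙ h0) (∨I₁ h0) (∨I₂ (≐-trans h0 h3))))
  (⇒I (∧E₂ (∀E h1 0) ∙ ∨E h0 (∨I₁ h0) (∨I₂ (≐-trans h0 (≐-sym h3))))))))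

IsPair-resp-snd : ∀ p j a a' →
  [] ⊢ (V a ≐ V a' ⇒ IsPair (V p) (V j) (V a) ⇒ IsPair (V p) (V j) (V a')) 0
IsPair-resp-snd p j a a' = ⇒I (⇒I (∀I (∧I
  (⇒I (∨E (∧E₁ (∀E h1 0) ∙ h0) (∨I₁ h0)
    (∨I₂ (wk (IsDbl-resp-snd 0 (suc j) (suc a) (suc a')) ∙ h3 ∙ h0))))
  (⇒I (∧E₂ (∀E h1 0) ∙ ∨E h0 (∨I₁ h0)
    (∨I₂ (wk (IsDbl-resp-snd 0 (suc j) (suc a') (suc a)) ∙ ≐-sym h3 ∙ h0)))))))

PairIn-resp-graph : ∀ j i A A' →
  [] ⊢ (V A ≐ V A' ⇒ PairIn (V j) (V i) (V A) ⇒ PairIn (V j) (V i) (V A')) 0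
PairIn-resp-graph j i A A' =
  ⇒I (⇒I (∃E h0 (∃I 0 (∧I (∈-respʳ-≐ h2 (∧E₁ h0)) (∧E₂ h0)))))

PairIn-resp-snd : ∀ j a a' A →
  [] ⊢ (V a ≐ V a' ⇒ PairIn (V j) (V a) (V A) ⇒ PairIn (V j) (V a') (V A)) 0
PairIn-resp-snd j a a' A = ⇒I (⇒I (∃E h0 (∃I 0 (∧I (∧E₁ h0)
  (wk (IsPair-resp-snd 0 (suc j) (suc a) (suc a')) ∙ h2 ∙ ∧E₂ h0)))))

InCar-resp-graph : ∀ j A A' →
  [] ⊢ (V A ≐ V A' ⇒ InCar (V j) (V A) ⇒ InCar (V j) (V A')) 0
InCar-resp-graph j A A' = ⇒I (⇒I (∧I
  (∃E (∧E₁ h0) (∃E h0 (∃I 1 (∃I 0 (∧I (∈-respʳ-≐ h3 (∧E₁ h0)) (∧E₂ h0))))))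
  (∃E (∧E₂ h0) (∃I 0 (∨E h0
     (∨I₁ (wk (PairIn-resp-graph (suc j) 0 (suc A) (suc A')) ∙ h3 ∙ h0))
     (∨I₂ (wk (PairIn-resp-graph 0 (suc j) (suc A) (suc A')) ∙ h3 ∙ h0)))))))

singleton-exists : ∀ A → [] ⊢ (Ex λ c → IsSing c (V A)) 0
singleton-exists A = ∃E (∀E (∀E (ax pairing) A) A) (∃I 0 (∀I (∧I
  (⇒I (∨E (∧E₁ (∀E h1 0) ∙ h0) h0 h0))
  (⇒I (∧E₂ (∀E h1 0) ∙ ∨I₁ h0)))))

fst-∈-pair-element : ∀ z A a → [] ⊢ (IsSing (V z) (V A) ∨ IsDbl (V z) (V A) (V a) ⇒ V A ∈' V z) 0
fst-∈-pair-element z A a = ⇒I (∨E h0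
  (∧E₂ (∀E h0 A) ∙ ≐-refl A)
  (∧E₂ (∀E h0 A) ∙ ∨I₁ (≐-refl A)))

snd-∈-IsDbl : ∀ z A a → [] ⊢ (IsDbl (V z) (V A) (V a) ⇒ V a ∈' V z) 0
snd-∈-IsDbl z A a = ⇒I (∧E₂ (∀E h0 a) ∙ ∨I₂ (≐-refl a))

∈-pair-element : ∀ z A a w →
  [] ⊢ (IsSing (V z) (V A) ∨ IsDbl (V z) (V A) (V a) ⇒ V w ∈' V z ⇒ V w ≐ V A ∨ V w ≐ V a) 0
∈-pair-element z A a w = ⇒I (⇒I (∨E h1 (∨I₁ (∧E₁ (∀E h0 w) ∙ h1)) (∧E₁ (∀E h0 w) ∙ h1)))

-- {A} ∈ ⟨A, a⟩ = ⟨A', a'⟩, so {A} is {A'} or {A', a'}; either way A' ∈ {A}.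
IsPair-injective₁ : ∀ g A a A' a' →
  [] ⊢ (IsPair (V g) (V A) (V a) ⇒ IsPair (V g) (V A') (V a') ⇒ V A ≐ V A') 0
IsPair-injective₁ g A a A' a' = ⇒I (⇒I (∃E (wk (singleton-exists A))
  (≐-sym (∧E₁ (∀E h0 (1 + A'))
    ∙ (wk (fst-∈-pair-element 0 (1 + A') (1 + a'))
       ∙ (∧E₁ (∀E h1 0) ∙ (∧E₂ (∀E h2 0) ∙ ∨I₁ h0)))))))

kuratowski-snd : ∀ a A A' a' →
  [] ⊢ ((V a ≐ V A' ∨ V a ≐ V a') ⇒ (V a' ≐ V A ∨ V a' ≐ V a) ⇒ V A ≐ V A' ⇒ V a ≐ V a') 0
kuratowski-snd a A A' a' = ⇒I (⇒I (⇒I (∨E h2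
  (∨E h2 (≐-trans h1 (≐-trans (≐-sym h2) (≐-sym h0))) (≐-sym h0))
  h0)))

-- a ∈ {A, a} ∈ ⟨A', a'⟩ and a' ∈ {A', a'} ∈ ⟨A, a⟩.
IsPair-injective₂ : ∀ g A a A' a' →
  [] ⊢ (IsPair (V g) (V A) (V a) ⇒ IsPair (V g) (V A') (V a') ⇒ V A ≐ V A' ⇒ V a ≐ V a') 0
IsPair-injective₂ g A a A' a' = ⇒I (⇒I (⇒I
  (∃E (∀E (∀E (ax pairing) A) a) (∃E (∀E (∀E (ax pairing) (1 + A')) (1 + a'))
    (wk (kuratowski-snd (2 + a) (2 + A) (2 + A') (2 + a'))
       ∙ (wk (∈-pair-element 1 (2 + A') (2 + a') (2 + a))
          ∙ (∧E₁ (∀E h3 1) ∙ (∧E₂ (∀E h4 1) ∙ ∨I₂ h1))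
          ∙ (wk (snd-∈-IsDbl 1 (2 + A) (2 + a)) ∙ h1))
       ∙ (wk (∈-pair-element 0 (2 + A) (2 + a) (2 + a'))
          ∙ (∧E₁ (∀E h4 0) ∙ (∧E₂ (∀E h3 0) ∙ ∨I₂ h0))
          ∙ (wk (snd-∈-IsDbl 0 (2 + A') (2 + a')) ∙ h0))
       ∙ h2)))))

IsPair-injective : ∀ g A a A' a' →
  [] ⊢ (IsPair (V g) (V A) (V a) ⇒ IsPair (V g) (V A') (V a') ⇒ V A ≐ V A' ∧ V a ≐ V a') 0
IsPair-injective g A a A' a' = ⇒I (⇒I (∧I A≐A' (wk (IsPair-injective₂ g A a A' a') ∙ h1 ∙ h0 ∙ A≐A')))
  where
  A≐A' : IsPair (V g) (V A') (V a') 0 ∷ IsPair (V g) (V A) (V a) 0 ∷ [] ⊢ A ≐ᶠ A'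
  A≐A' = wk (IsPair-injective₁ g A a A' a') ∙ h1 ∙ h0

Collapse-function : ∀ {Γ φ ψ χ ω} → Γ ⊢ φ ∧ᶠ ψ ∧ᶠ χ ∧ᶠ ω → Γ ⊢ ψ
Collapse-function c = ∧E₁ (∧E₂ c)

Collapse-dom : ∀ {Γ φ ψ χ ω} → Γ ⊢ φ ∧ᶠ ψ ∧ᶠ χ ∧ᶠ ω → Γ ⊢ χ
Collapse-dom c = ∧E₁ (∧E₂ (∧E₂ c))

Collapse-app : ∀ {Γ φ ψ χ ω} → Γ ⊢ φ ∧ᶠ ψ ∧ᶠ χ ∧ᶠ ω → Γ ⊢ ω
Collapse-app c = ∧E₂ (∧E₂ (∧E₂ c))

Function-unique : ∀ {Γ} ψ i t t' → Γ ⊢ Function (V ψ) 0 →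
  Γ ⊢ PairIn (V i) (V t) (V ψ) 0 → Γ ⊢ PairIn (V i) (V t') (V ψ) 0 → Γ ⊢ t ≐ᶠ t'
Function-unique ψ i t t' f p q = ∀E (∀E (∀E (∧E₂ f) i) t) t' ∙ ∧I p q

Collapse-dom-transfer : ∀ j A φ A' ψ →
  [] ⊢ (Collapse (V A) (V φ) ⇒ Collapse (V A') (V ψ) ⇒ V A ≐ V A'
        ⇒ InDom (V j) (V φ) ⇒ InDom (V j) (V ψ)) 0
Collapse-dom-transfer j A φ A' ψ = ⇒I (⇒I (⇒I (⇒I
  (∧E₂ (∀E (Collapse-dom h2) j)
    ∙ (wk (InCar-resp-graph j A A') ∙ h1 ∙ (∧E₁ (∀E (Collapse-dom h3) j) ∙ h0))))))

Collapse-edge⇒∈ : ∀ A ψ i j s t →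
  [] ⊢ (Collapse (V A) (V ψ) ⇒ PairIn (V j) (V i) (V A)
        ⇒ PairIn (V j) (V s) (V ψ) ⇒ PairIn (V i) (V t) (V ψ) ⇒ V s ∈' V t) 0
Collapse-edge⇒∈ A ψ i j s t = ⇒I (⇒I (⇒I (⇒I
  (∃E (∧E₂ (∀E (∀E (Collapse-app h3) i ∙ ∃I t h0) s)
         ∙ ∃I j (∧I (∃I s h1) (∧I h2 (∃I s (∧I h1 (≐-refl s))))))
      (∈-respʳ-≐ (Function-unique (suc ψ) (suc i) 0 (suc t) (Collapse-function h4) (∧E₁ h0) h1)
                 (∧E₂ h0))))))

Bisim : Tm → Tm → Tm → Tm → Tm → Tm → F
Bisim φ ψ x y u w = (Ex λ i → EqApp u φ i ∧ EqApp w ψ i) ∨ (u ≐ x ∧ w ≐ y)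

Bisim-swap : ∀ φ ψ x y u w →
  [] ⊢ (Bisim (V φ) (V ψ) (V x) (V y) (V u) (V w) ⇒ Bisim (V ψ) (V φ) (V y) (V x) (V w) (V u)) 0
Bisim-swap φ ψ x y u w = ⇒I (∨E h0
  (∨I₁ (∃E h0 (∃I 0 (∧I (∧E₂ h0) (∧E₁ h0)))))
  (∨I₂ (∧I (∧E₂ h0) (∧E₁ h0))))

-- From u = φ(i), w = ψ(i) and u' ∈ u, the app clause of the collapse gives j
-- with ⟨j, i⟩ ∈ A and u' = φ(j); j ∈ Dom ψ, and w' := ψ(j) ∈ ψ(i) = w.
bisim-forth-app : ∀ x y A φ A' ψ u u' w →
  [] ⊢ (Collapse (V A) (V φ) ⇒ Collapse (V A') (V ψ) ⇒ V A ≐ V A'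
        ⇒ V u' ∈' V u ⇒ (Ex λ i → EqApp (V u) (V φ) i ∧ EqApp (V w) (V ψ) i)
        ⇒ Ex λ w' → w' ∈' V w ∧ Bisim (V φ) (V ψ) (V x) (V y) (V u') w') 0
bisim-forth-app x y A φ A' ψ u u' w = ⇒I (⇒I (⇒I (⇒I (⇒I
  (∃E h0 (∃E (∧E₁ h0) (∃E (∧E₂ h1)
    (∃E (∧E₁ (∀E (∀E (Collapse-app h7) 2 ∙ ∃I 1 (∧E₁ h1)) (3 + u'))
           ∙ ∃I 1 (∧I (∧E₁ h1) (∈-respʳ-≐ (∧E₂ h1) h4)))
      (∃E (wk (Collapse-dom-transfer 0 (4 + A) (4 + φ) (4 + A') (4 + ψ)) ∙ h8 ∙ h7 ∙ h6 ∙ ∧E₁ h0)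
        (∃I 0 (∧I
          (∈-respʳ-≐ (≐-sym (∧E₂ h2))
             (wk (Collapse-edge⇒∈ (5 + A') (5 + ψ) 4 1 0 2) ∙ h8
                  ∙ (wk (PairIn-resp-graph 1 4 (5 + A) (5 + A')) ∙ h7 ∙ ∧E₁ (∧E₂ h1))
                  ∙ h0 ∙ ∧E₁ h2))
          (∨I₁ (∃I 1 (∧I (∧E₂ (∧E₂ h1)) (∃I 0 (∧I h0 (≐-refl 0)))))))))))))))))

-- From u = x, w = y and u' ∈ x, the hat clause gives j with ⟨j, a⟩ ∈ A and
-- u' = φ(j); j ∈ Dom ψ, and w' := ψ(j) ∈ y since ⟨j, a'⟩ ∈ A'.
bisim-forth-root : ∀ x y A a φ A' a' ψ u u' w →
  [] ⊢ (Collapse (V A) (V φ) ⇒ IsHat (V x) (V φ) (V A) (V a)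
        ⇒ Collapse (V A') (V ψ) ⇒ IsHat (V y) (V ψ) (V A') (V a') ⇒ V A ≐ V A' ⇒ V a ≐ V a'
        ⇒ V u' ∈' V u ⇒ (V u ≐ V x ∧ V w ≐ V y)
        ⇒ Ex λ w' → w' ∈' V w ∧ Bisim (V φ) (V ψ) (V x) (V y) (V u') w') 0
bisim-forth-root x y A a φ A' a' ψ u u' w = ⇒I (⇒I (⇒I (⇒I (⇒I (⇒I (⇒I (⇒I
  (∃E (∧E₂ (∧E₁ (∀E h6 u') ∙ ∈-respʳ-≐ (∧E₁ h0) h1))
    (∃E (wk (Collapse-dom-transfer 0 (1 + A) (1 + φ) (1 + A') (1 + ψ))
           ∙ h8 ∙ h6 ∙ h4 ∙ ∃I (1 + u') (∧E₂ h0))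
      (∃I 0 (∧I
        (∈-respʳ-≐ (≐-sym (∧E₂ h2))
           (∧E₂ (∀E h6 0) ∙ ∧I (∃I 1 h0) (∃I 1 (∧I
              (wk (PairIn-resp-snd 1 (2 + a) (2 + a') (2 + A')) ∙ h4
                 ∙ (wk (PairIn-resp-graph 1 (2 + a) (2 + A) (2 + A')) ∙ h5 ∙ ∧E₁ h1))
              h0))))
        (∨I₁ (∃I 1 (∧I (∃I (2 + u') (∧I (∧E₂ h1) (≐-refl (2 + u'))))
                       (∃I 0 (∧I h0 (≐-refl 0)))))))))))))))))

bisim-forth : ∀ x y A a φ A' a' ψ →
  [] ⊢ (Collapse (V A) (V φ) ⇒ IsHat (V x) (V φ) (V A) (V a)
        ⇒ Collapse (V A') (V ψ) ⇒ IsHat (V y) (V ψ) (V A') (V a') ⇒ V A ≐ V A' ⇒ V a ≐ V a'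
        ⇒ All λ u → All λ u' → All λ w → (u' ∈' u ∧ Bisim (V φ) (V ψ) (V x) (V y) u w)
           ⇒ Ex λ w' → w' ∈' w ∧ Bisim (V φ) (V ψ) (V x) (V y) u' w') 0
bisim-forth x y A a φ A' a' ψ = ⇒I (⇒I (⇒I (⇒I (⇒I (⇒I (∀I (∀I (∀I (⇒I
  (∨E (∧E₂ h0)
    (wk (bisim-forth-app (3 + x) (3 + y) (3 + A) (3 + φ) (3 + A') (3 + ψ) 2 1 0)
       ∙ h7 ∙ h5 ∙ h3 ∙ ∧E₁ h1 ∙ h0)
    (wk (bisim-forth-root (3 + x) (3 + y) (3 + A) (3 + a) (3 + φ) (3 + A') (3 + a') (3 + ψ) 2 1 0)
       ∙ h7 ∙ h6 ∙ h5 ∙ h4 ∙ h3 ∙ h2 ∙ ∧E₁ h1 ∙ h0)))))))))))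

bisim-back : ∀ x y A a φ A' a' ψ →
  [] ⊢ (Collapse (V A) (V φ) ⇒ IsHat (V x) (V φ) (V A) (V a)
        ⇒ Collapse (V A') (V ψ) ⇒ IsHat (V y) (V ψ) (V A') (V a') ⇒ V A ≐ V A' ⇒ V a ≐ V a'
        ⇒ All λ w → All λ w' → All λ u → (w' ∈' w ∧ Bisim (V φ) (V ψ) (V x) (V y) u w)
           ⇒ Ex λ u' → u' ∈' u ∧ Bisim (V φ) (V ψ) (V x) (V y) u' w') 0
bisim-back x y A a φ A' a' ψ = ⇒I (⇒I (⇒I (⇒I (⇒I (⇒I (∀I (∀I (∀I (⇒I
  (∃E (∀E (∀E (∀E (wk (bisim-forth (3 + y) (3 + x) (3 + A') (3 + a') (3 + ψ) (3 + A) (3 + a) (3 + φ))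
                      ∙ h4 ∙ h3 ∙ h6 ∙ h5 ∙ ≐-sym h2 ∙ ≐-sym h1) 2) 1) 0
        ∙ ∧I (∧E₁ h0) (wk (Bisim-swap (3 + φ) (3 + ψ) (3 + x) (3 + y) 0 2) ∙ ∧E₂ h0))
    (∃I 0 (∧I (∧E₁ h0) (wk (Bisim-swap (4 + ψ) (4 + φ) (4 + y) (4 + x) 2 0) ∙ ∧E₂ h0)))))))))))))

-- Strong Extensionality instantiated with R := Bisim φ ψ x y, whose
-- distinguished variables u, w are indices 0, 1 and whose parameters n sit at
-- n + 2; here x, y, φ, ψ are the indices 7, 6, 3, 0 under the eight binders.
hat-unique : Z-st⊢ ((All λ x → All λ y → All λ A → All λ a → All λ φ →
                     All λ A' → All λ a' → All λ ψ →
  Collapse A φ ⇒ IsHat x φ A a ⇒ Collapse A' ψ ⇒ IsHat y ψ A' a'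
  ⇒ (A ≐ A' ∧ a ≐ a') ⇒ x ≐ y) 0)
hat-unique = ∀I (∀I (∀I (∀I (∀I (∀I (∀I (∀I (⇒I (⇒I (⇒I (⇒I (⇒I
  (∀E (∀E (ax (strong-ext (Bisim (V 5) (V 2) (V 9) (V 8) (V 0) (V 1) 0))) 7) 6
    ∙ ∧I (∨I₂ (∧I (≐-refl 7) (≐-refl 6)))
         (∧I (wk (bisim-forth 7 6 5 4 3 2 1 0) ∙ h4 ∙ h3 ∙ h2 ∙ h1 ∙ ∧E₁ h0 ∙ ∧E₂ h0)
             (wk (bisim-back  7 6 5 4 3 2 1 0) ∙ h4 ∙ h3 ∙ h2 ∙ h1 ∙ ∧E₁ h0 ∙ ∧E₂ h0)))))))))))))))

proposition5 : Z-st⊢ reifUnique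
proposition5 = ∀I (∀I (∀I (⇒I
  (∃E (∧E₁ h0) (∃E h0 (∃E h0 (∃E (∧E₂ h3) (∃E h0 (∃E h0
    (∀E (∀E (∀E (∀E (∀E (∀E (∀E (∀E (wk hat-unique) 7) 6) 5) 4) 3) 2) 1) 0
       ∙ ∧E₁ (∧E₂ h3) ∙ ∧E₂ (∧E₂ h3) ∙ ∧E₁ (∧E₂ h0) ∙ ∧E₂ (∧E₂ h0)
       ∙ (wk (IsPair-injective 8 5 4 2 1) ∙ ∧E₁ h3 ∙ ∧E₁ h0)))))))))))
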